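{- Let $q$ be a prime power, let $m,n,k$ be integers with $2\le k<n\le m$, and let $\lambda\in\mathbb{F}_{q^m}$ with $\mathbb{F}_q(\lambda)=\mathbb{F}_{q^m}$. Let $S=\{i\in\mathbb{Z}_{\ge 0}: (n-i)/2^{k-i-1}\ge 1\}$ and $z=\min S$. If $z=0$, let $\mathbf n=\Psi(n,k)$; if $z>0$, let $(n_1,\dots,n_{k-z})=\Psi(n-z,k-z)$ and $\mathbf n=(n_1,\dots,n_{k-z},1,\dots,1)$ with $z$ trailing ones. Then the $[n,k]_{q^m/q}$ code $\mathcal C_{\lambda,\mathbf n}$ satisfies $$\mathrm{WS}(\mathcal C_{\lambda,\mathbf n})=\{s,s+1,\dots,n\},\qquad s=\max\left\{\left\lfloor \frac{n}{2^{k-1}}\right\rfloor,1\right\},$$ so it has exactly $n-s+1$ distinct nonzero weights.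
   Context: $\mathbb{F}_{q^m}$ is the degree-$m$ extension of $\mathbb{F}_q$. Rank weight of $\mathbf v=(v_1,\dots,v_n)\in\mathbb{F}_{q^m}^n$: $\mathrm{w}(\mathbf v)=\dim_{\mathbb{F}_q}\langle v_1,\dots,v_n\rangle_{\mathbb{F}_q}$. An $[n,k]_{q^m/q}$ code is a $k$-dimensional $\mathbb{F}_{q^m}$-subspace of $\mathbb{F}_{q^m}^n$; its weight spectrum is $\mathrm{WS}(\mathcal C)=\{\mathrm{w}(\mathbf c):\mathbf c\in\mathcal C\setminus\{\mathbf 0\}\}$. For integers $u\ge v\ge 2$, $\Psi(u,v):=(u_1,\dots,u_v)$ with $u_1=\lceil u/2\rceil$, $u_i=\lceil\lfloor u/2^{i-1}\rfloor/2\rceil$ for $2\le i\le v-1$, $u_v=\lfloor u/2^{v-1}\rfloor$. For $\ell\le m$, $\mathbf u_{\lambda,\ell}=(1,\lambda,\dots,\lambda^{\ell-1})\in\mathbb{F}_{q^m}^\ell$. For a tuple $\mathbf n=(n_1,\dots,n_k)$ of integers with $m\ge n_1\ge\dots\ge n_k\ge1$, $\mathcal C_{\lambda,\mathbf n}$ is the code in $\mathbb{F}_{q^m}^{n_1+\dots+n_k}$ with block-diagonal generator matrix whose $i$-th row equals $\mathbf u_{\lambda,n_i}$ on the $i$-th block of $n_i$ coordinates (blocks of consecutive coordinates of lengths $n_1,\dots,n_k$) and $0$ elsewhere. -}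

module Defs where

open import Level using (0ℓ)
open import Algebra.Bundles using (CommutativeRing)
open import Data.Nat using (ℕ; zero; suc; _∸_; _^_; _≤_; _<_; _⊔_; _/_)
import Data.Nat as N
import Data.Fin as F
open import Data.Nat.Properties using (m^n≢0)
open import Data.Nat.Primality using (Prime)
open import Data.Fin using (Fin)
open import Data.List using (List; []; _∷_; _++_; map; replicate; upTo; length; lookup; concat; zip)
open import Data.Product using (proj₁; proj₂; Σ; _×_; _,_; ∃; ∃-syntax)
open import Data.Sum using (_⊎_)
open import Relation.Nullary using (¬_)
open import Relation.Binary.PropositionalEquality using (_≡_)

record Field : Set₁ where
  field
    commRing : CommutativeRing 0ℓ 0ℓ
  open CommutativeRing commRing public
  field
    1≉0     : ¬ (1# ≈ 0#)
    inverse : ∀ x → ¬ (x ≈ 0#) → ∃[ y ] (x * y ≈ 1#)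

module FieldTheory (L : Field) where
  open Field L

  Σᶠ : ∀ {r} → (Fin r → Carrier) → Carrier
  Σᶠ {zero}  f = 0#
  Σᶠ {suc r} f = f F.zero + Σᶠ (λ i → f (F.suc i))

  record IsSubfield (P : Carrier → Set) : Set where
    field
      resp  : ∀ {x y} → x ≈ y → P x → P y
      has0  : P 0#
      has1  : P 1#
      close+ : ∀ {x y} → P x → P y → P (x + y)
      close- : ∀ {x} → P x → P (- x)
      close* : ∀ {x y} → P x → P y → P (x * y)
      closeInv : ∀ {x y} → P x → ¬ (x ≈ 0#) → x * y ≈ 1# → P y

  module OverSubfield (K : Carrier → Set) where

    InSpan : ∀ {r} → (Fin r → Carrier) → Carrier → Set
    InSpan {r} v x = Σ (Fin r → Carrier) λ c → (∀ i → K (c i)) × (x ≈ Σᶠ (λ i → c i * v i))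

    Independent : ∀ {r} → (Fin r → Carrier) → Set
    Independent {r} v = ∀ (c : Fin r → Carrier) → (∀ i → K (c i)) →
                        Σᶠ (λ i → c i * v i) ≈ 0# → ∀ i → c i ≈ 0#

    SpanDim : ∀ {r} → (Fin r → Carrier) → ℕ → Set
    SpanDim {r} v d = Σ (Fin d → Carrier) λ b →
      Independent b × (∀ j → InSpan v (b j)) × (∀ i → InSpan b (v i))

    RankWeight : List Carrier → ℕ → Set
    RankWeight xs d = SpanDim (lookup xs) d

    Generates : Carrier → Set₁
    Generates λ₀ = ∀ (P : Carrier → Set) → IsSubfield P →
                   (∀ {x} → K x → P x) → P λ₀ → ∀ x → P x

    Degree : ℕ → Set
    Degree m = Σ (Fin m → Carrier) λ b → Independent b × (∀ x → InSpan b x)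

  HasCard : (Carrier → Set) → ℕ → Set
  HasCard K q = Σ (Fin q → Carrier) λ ι →
    (∀ i j → ι i ≈ ι j → i ≡ j) × (∀ x → (K x → ∃[ i ] (x ≈ ι i)) × (∀ i → x ≈ ι i → K x))

  pow : Carrier → ℕ → Carrier
  pow x zero    = 1#
  pow x (suc e) = x * pow x e

  u : Carrier → ℕ → List Carrier
  u λ₀ ℓ = map (pow λ₀) (upTo ℓ)

  -- the codeword a·G of C_{λ,n}, where G is block diagonal with i-th row u_{λ,n_i}
  -- on the i-th block: it is the concatenation of the blocks a_i · u_{λ,n_i}
  codeword : Carrier → List ℕ → List Carrier → List Carrier
  codeword λ₀ ns as = concat (map (λ p → map (proj₁ p *_) (u λ₀ (proj₂ p))) (zip as ns))

  Nonzero : List Carrier → Set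
  Nonzero xs = ∃[ i ] ¬ (lookup xs i ≈ 0#)

prime-power : ℕ → Set
prime-power q = ∃[ p ] ∃[ e ] (Prime p × q ≡ p ^ suc e)

_/2^_ : ℕ → ℕ → ℕ
a /2^ j = _/_ a (2 ^ j) {{m^n≢0 2 j}}

⌈_/2⌉ : ℕ → ℕ
⌈ x /2⌉ = (x N.+ 1) / 2

Ψ : ℕ → ℕ → List ℕ
Ψ a b = map (λ j → ⌈ a /2^ j /2⌉) (upTo (b ∸ 1)) ++ (a /2^ (b ∸ 1) ∷ [])

-- i ∈ S  iff  (n - i) / 2^{k-i-1} ≥ 1 (rational inequality), unfolded:
--   for i < k : 2^{k-1-i} ≤ n - i ;  for i ≥ k : (n-i)·2^{i-k+1} ≥ 1, i.e. i < n
InS : ℕ → ℕ → ℕ → Set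
InS n k i = (i < k × 2 ^ (k ∸ suc i) N.+ i ≤ n) ⊎ (k ≤ i × i < n)

tuple : ℕ → ℕ → ℕ → List ℕ
tuple n k zero    = Ψ n k
tuple n k (suc z) = Ψ (n ∸ suc z) (k ∸ suc z) ++ replicate (suc z) 1

smin : ℕ → ℕ → ℕ
smin n k = (n /2^ (k ∸ 1)) ⊔ 1

{-# OPTIONS --safe #-}
module Submission where

-- A codeword of C_{λ,𝐧} is a concatenation of blocks aᵢ·(1, λ, …, λ^(nᵢ-1)). Since K(λ) = L has degree m
-- over K, the powers 1, λ, …, λ^(m-1) are K-independent: if λ^t lay in the span of 1, …, λ^(t-1) for
-- some t < m, that span would be a finite subring containing K and λ, hence a subfield, hence all of L.
-- So a nonzero block contributes nᵢ ≥ s independent entries, and s ≤ weight ≤ length = n. Conversely,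
-- taking each aᵢ to be 0 or a power of λ, a greedy choice makes the entries exactly λ^0, …, λ^(d-1) for
-- any s ≤ d ≤ n; it succeeds because every part of 𝐧 (halvings of n - z, then z ones) is at least s and
-- is either s or at most one more than the sum of the later parts. Dimensions are compared by counting:
-- over the q-element field K, r vectors span at most q^r elements.

open import Defs
open import Data.Nat as ℕ using (ℕ; zero; suc; _≤_; _<_; z≤n; s≤s)
import Data.Nat.Properties as ℕ
open import Data.Nat.ListAction using (sum)
open import Data.Fin as Fin using (Fin; zero; suc; toℕ; fromℕ; inject₁; funToFin; finToFun)
import Data.Fin.Properties as Fin
import Data.Fin.Relation.Unary.Top as Top
open import Data.Vec.Functional using (init; last)
open import Data.List using (List; []; _∷_; _++_; map; applyUpTo; upTo; length; lookup)
open import Data.List.Properties using (length-++; length-map; length-upTo)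
open import Data.List.Membership.Propositional using (_∈_)
open import Data.List.Membership.Propositional.Properties
  using (∈-++⁻; ∈-++⁺ˡ; ∈-++⁺ʳ; ∈-map⁻; ∈-map⁺; ∈-upTo⁻; ∈-upTo⁺; ∈-applyUpTo⁻; ∈-applyUpTo⁺; ∈-lookup)
open import Data.List.Relation.Binary.Subset.Propositional using (_⊆_)
open import Data.List.Relation.Unary.Any as Any using (here; there)
open import Data.List.Relation.Unary.Any.Properties using (lookup-index)
open import Data.Maybe using (Maybe; just; nothing)
open import Data.Product using (∃-syntax; _×_; _,_; proj₁; proj₂)
open import Data.Sum using (_⊎_; inj₁; inj₂)
open import Function using (id; _∘_)
open import Function.Definitions using (Injective)
open import Relation.Nullary using (¬_; contradiction; Dec; yes; no)
open import Relation.Nullary.Decidable using (map′)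
import Relation.Binary.PropositionalEquality as ≡
open ≡ using (_≡_)

module Tuples where
  open import Data.Nat using (_+_; _∸_; _^_; _⊔_; _/_; NonZero)
  open import Data.Nat.DivMod using (m/n≡1+[m∸n]/n; /-congʳ; m/n/o≡m/[n*o]; n/1≡n; m≥n⇒m/n>0; m<n⇒m/n≡0; m<n*o⇒m/o<n)
  open import Data.Nat.ListAction.Properties using (sum-++)
  open import Data.List using ([_]; replicate)
  open import Data.List.Properties using (length-replicate; ++-identityʳ)
  open ≡ using (refl; sym; trans; cong; cong₂; subst; subst₂; module ≡-Reasoning)

  n/2≡⌊n/2⌋ : ∀ n → n / 2 ≡ ℕ.⌊ n /2⌋
  n/2≡⌊n/2⌋ 0             = refl
  n/2≡⌊n/2⌋ 1             = refl
  n/2≡⌊n/2⌋ (suc (suc n)) = trans (m/n≡1+[m∸n]/n {suc (suc n)} {2} (s≤s (s≤s z≤n))) (cong suc (n/2≡⌊n/2⌋ n))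

  [n+1]/2≡⌈n/2⌉ : ∀ n → ⌈ n /2⌉ ≡ ℕ.⌈ n /2⌉
  [n+1]/2≡⌈n/2⌉ n = trans (n/2≡⌊n/2⌋ (n + 1)) (cong ℕ.⌊_/2⌋ (ℕ.+-comm n 1))

  IsHalving : (ℕ → ℕ) → Set
  IsHalving g = ∀ j → g (suc j) ≡ ℕ.⌊ g j /2⌋

  /2^-isHalving : ∀ a → IsHalving (a /2^_)
  /2^-isHalving a j = begin
    a / (2 ^ suc j)     ≡⟨ /-congʳ (ℕ.*-comm 2 (2 ^ j)) ⟩
    a / (2 ^ j ℕ.* 2)   ≡⟨ m/n/o≡m/[n*o] a (2 ^ j) 2 ⟨
    a /2^ j / 2         ≡⟨ n/2≡⌊n/2⌋ (a /2^ j) ⟩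
    ℕ.⌊ a /2^ j /2⌋     ∎
    where
    open ≡-Reasoning
    instance
      2^j≢0 : NonZero (2 ^ j)
      2^j≢0 = ℕ.m^n≢0 2 j
      2^[1+j]≢0 : NonZero (2 ^ suc j)
      2^[1+j]≢0 = ℕ.m^n≢0 2 (suc j)
      2^j*2≢0 : NonZero (2 ^ j ℕ.* 2)
      2^j*2≢0 = ℕ.m*n≢0 (2 ^ j) 2

  halvings : (ℕ → ℕ) → ℕ → List ℕ
  halvings g zero    = [ g 0 ]
  halvings g (suc c) = ℕ.⌈ g 0 /2⌉ ∷ halvings (g ∘ suc) c

  Ψ≡halvings : ∀ a c → Ψ a (suc c) ≡ halvings (a /2^_) c
  Ψ≡halvings a = shifted id
    where
    shifted : ∀ f c → map (λ j → ⌈ a /2^ j /2⌉) (applyUpTo f c) ++ [ a /2^ f c ] ≡ halvings (λ j → a /2^ f j) c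
    shifted f zero    = refl
    shifted f (suc c) = cong₂ _∷_ ([n+1]/2≡⌈n/2⌉ (a /2^ f 0)) (shifted (f ∘ suc) c)

  length-halvings : ∀ g c → length (halvings g c) ≡ suc c
  length-halvings g zero    = refl
  length-halvings g (suc c) = cong suc (length-halvings (g ∘ suc) c)

  sum-halvings : ∀ {g} → IsHalving g → ∀ c → sum (halvings g c) ≡ g 0
  sum-halvings {g} g-half zero    = ℕ.+-identityʳ (g 0)
  sum-halvings {g} g-half (suc c) = begin
    ℕ.⌈ g 0 /2⌉ + sum (halvings (g ∘ suc) c) ≡⟨ cong (ℕ.⌈ g 0 /2⌉ +_) (sum-halvings (g-half ∘ suc) c) ⟩
    ℕ.⌈ g 0 /2⌉ + g 1                         ≡⟨ cong (ℕ.⌈ g 0 /2⌉ +_) (g-half 0) ⟩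
    ℕ.⌈ g 0 /2⌉ + ℕ.⌊ g 0 /2⌋                 ≡⟨ ℕ.+-comm _ (ℕ.⌊ g 0 /2⌋) ⟩
    ℕ.⌊ g 0 /2⌋ + ℕ.⌈ g 0 /2⌉                 ≡⟨ ℕ.⌊n/2⌋+⌈n/2⌉≡n (g 0) ⟩
    g 0                                       ∎
    where open ≡-Reasoning

  halving-≤ : ∀ {g} → IsHalving g → ∀ c → g c ≤ g 0
  halving-≤ g-half zero    = ℕ.≤-refl
  halving-≤ {g} g-half (suc c) = ℕ.≤-trans (halving-≤ (g-half ∘ suc) c)
    (subst (_≤ g 0) (sym (g-half 0)) (ℕ.⌊n/2⌋≤n (g 0)))

  -- The property that lets the greedy choice below realise every weight from s to the total.
  data Admissible (s : ℕ) : List ℕ → Set where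
    []   : Admissible s []
    cons : ∀ {x xs} → s ≤ x → x ≤ s ⊎ x ≤ suc (sum xs) → Admissible s xs → Admissible s (x ∷ xs)

  admissible-halvings : ∀ {s g rest} → IsHalving g → ∀ c → g c ≡ s → Admissible s rest →
                        Admissible s (halvings g c ++ rest)
  admissible-halvings g-half zero    refl adm = cons ℕ.≤-refl (inj₁ ℕ.≤-refl) adm
  admissible-halvings {s} {g} {rest} g-half (suc c) gc≡s adm =
    cons s≤head (inj₂ head≤) (admissible-halvings (g-half ∘ suc) c gc≡s adm)
    where
    open ℕ.≤-Reasoning
    s≤head : s ≤ ℕ.⌈ g 0 /2⌉
    s≤head = begin
      s           ≡⟨ sym gc≡s ⟩
      g (suc c)   ≤⟨ halving-≤ (g-half ∘ suc) c ⟩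
      g 1         ≡⟨ g-half 0 ⟩
      ℕ.⌊ g 0 /2⌋ ≤⟨ ℕ.⌊n/2⌋≤⌈n/2⌉ (g 0) ⟩
      ℕ.⌈ g 0 /2⌉ ∎
    head≤ : ℕ.⌈ g 0 /2⌉ ≤ suc (sum (halvings (g ∘ suc) c ++ rest))
    head≤ = begin
      ℕ.⌈ g 0 /2⌉                                  ≤⟨ ℕ.⌊n/2⌋-mono (ℕ.n≤1+n (suc (g 0))) ⟩
      suc ℕ.⌊ g 0 /2⌋                              ≡⟨ cong suc (sym (g-half 0)) ⟩
      suc (g 1)                                    ≡⟨ cong suc (sum-halvings (g-half ∘ suc) c) ⟨
      suc (sum (halvings (g ∘ suc) c))             ≤⟨ s≤s (ℕ.m≤m+n _ (sum rest)) ⟩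
      suc (sum (halvings (g ∘ suc) c) + sum rest)  ≡⟨ cong suc (sum-++ (halvings (g ∘ suc) c) rest) ⟨
      suc (sum (halvings (g ∘ suc) c ++ rest))     ∎

  admissible-ones : ∀ z → Admissible 1 (replicate z 1)
  admissible-ones zero    = []
  admissible-ones (suc z) = cons ℕ.≤-refl (inj₁ ℕ.≤-refl) (admissible-ones z)

  sum-ones : ∀ z → sum (replicate z 1) ≡ z
  sum-ones zero    = refl
  sum-ones (suc z) = cong suc (sum-ones z)

  admissible-∈⇒≥ : ∀ {s x xs} → Admissible s xs → x ∈ xs → s ≤ x
  admissible-∈⇒≥ (cons s≤x _ _) (here refl)  = s≤x
  admissible-∈⇒≥ (cons _ _ adm) (there x∈xs) = admissible-∈⇒≥ adm x∈xs

  ∈⇒≤sum : ∀ {x xs} → x ∈ xs → x ≤ sum xs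
  ∈⇒≤sum {xs = y ∷ ys} (here refl)  = ℕ.m≤m+n y (sum ys)
  ∈⇒≤sum {xs = y ∷ ys} (there x∈ys) = ℕ.≤-trans (∈⇒≤sum x∈ys) (ℕ.m≤n+m (sum ys) y)

  record WeightProfile (n k s : ℕ) (ns : List ℕ) : Set where
    constructor profile
    field
      length≡ : length ns ≡ k
      sum≡    : sum ns ≡ n
      admissible : Admissible s ns

  tuple-profile-zero : ∀ {n} c → 2 ^ c ≤ n → WeightProfile n (suc c) (smin n (suc c)) (tuple n (suc c) 0)
  tuple-profile-zero {n} c 2^c≤n rewrite Ψ≡halvings n c =
    profile (length-halvings g c) (trans (sum-halvings (/2^-isHalving n) c) (n/1≡n n))
    (subst (λ ns → Admissible (smin n (suc c)) ns) (++-identityʳ (halvings g c))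
      (admissible-halvings (/2^-isHalving n) c (sym smin≡gc) []))
    where
    g : ℕ → ℕ
    g = n /2^_
    smin≡gc : smin n (suc c) ≡ g c
    smin≡gc = ℕ.m≥n⇒m⊔n≡m (m≥n⇒m/n>0 {{ℕ.m^n≢0 2 c}} 2^c≤n)

  tuple-profile-suc : ∀ {n} z c → 2 ^ c + suc z ≤ n × n < 2 ^ suc c + z × n < 2 ^ (z + suc c) →
                      WeightProfile n (suc z + suc c) (smin n (suc z + suc c)) (tuple n (suc z + suc c) (suc z))
  tuple-profile-suc {n} z c (2^c+1+z≤n , n<2^[1+c]+z , n<2^[z+1+c]) =
    subst₂ (WeightProfile n (suc z + suc c)) (sym smin≡1) (sym tuple≡) (profile length≡ sum≡ admissible)
    where
    a : ℕ
    a = n ∸ suc z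
    g : ℕ → ℕ
    g = a /2^_
    ns : List ℕ
    ns = halvings g c ++ replicate (suc z) 1
    tuple≡ : tuple n (suc z + suc c) (suc z) ≡ ns
    tuple≡ = cong (_++ replicate (suc z) 1) (trans (cong (Ψ a) (ℕ.m+n∸m≡n z (suc c))) (Ψ≡halvings a c))
    smin≡1 : smin n (suc z + suc c) ≡ 1
    smin≡1 = cong (_⊔ 1) (m<n⇒m/n≡0 {{ℕ.m^n≢0 2 (z + suc c)}} n<2^[z+1+c])
    1+z≤n : suc z ≤ n
    1+z≤n = ℕ.≤-trans (ℕ.m≤n+m (suc z) (2 ^ c)) 2^c+1+z≤n
    a<2*2^c : a < 2 ℕ.* 2 ^ c
    a<2*2^c = ℕ.m<n+o⇒m∸n<o n (suc z) {{ℕ.m^n≢0 2 (suc c)}}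
      (ℕ.<-≤-trans n<2^[1+c]+z (ℕ.≤-trans (ℕ.≤-reflexive (ℕ.+-comm _ z)) (ℕ.n≤1+n _)))
    gc≡1 : g c ≡ 1
    gc≡1 = ℕ.≤-antisym (ℕ.<⇒≤pred (m<n*o⇒m/o<n {{ℕ.m^n≢0 2 c}} a<2*2^c))
                       (m≥n⇒m/n>0 {{ℕ.m^n≢0 2 c}} (ℕ.m+n≤o⇒m≤o∸n (2 ^ c) 2^c+1+z≤n))
    length≡ : length ns ≡ suc z + suc c
    length≡ = begin
      length ns                                             ≡⟨ length-++ (halvings g c) ⟩
      length (halvings g c) + length (replicate (suc z) 1)  ≡⟨ cong₂ _+_ (length-halvings g c) (length-replicate (suc z)) ⟩
      suc c + suc z                                         ≡⟨ ℕ.+-comm (suc c) (suc z) ⟩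
      suc z + suc c                                         ∎
      where open ≡-Reasoning
    sum≡ : sum ns ≡ n
    sum≡ = begin
      sum ns                                          ≡⟨ sum-++ (halvings g c) (replicate (suc z) 1) ⟩
      sum (halvings g c) + sum (replicate (suc z) 1)  ≡⟨ cong₂ _+_ (sum-halvings (/2^-isHalving a) c) (sum-ones (suc z)) ⟩
      a / 1 + suc z                                   ≡⟨ cong (_+ suc z) (n/1≡n a) ⟩
      a + suc z                                       ≡⟨ ℕ.m∸n+n≡m 1+z≤n ⟩
      n                                               ∎
      where open ≡-Reasoning
    admissible : Admissible 1 ns
    admissible = admissible-halvings (/2^-isHalving a) c gc≡1 (admissible-ones (suc z))

  last-index∈S : ∀ {n k} → suc k ≤ n → InS n (suc k) k
  last-index∈S {n} {k} 1+k≤n = inj₁ (ℕ.n<1+n k , subst (λ e → 2 ^ e + k ≤ n) (sym (ℕ.n∸n≡0 k)) 1+k≤n)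

  -- The three bounds come from z + 1 ∈ S, z ∉ S and 0 ∉ S respectively.
  least-S-bounds : ∀ {n k} z c → suc z + suc c ≡ k → InS n k (suc z) → (∀ i → i < suc z → ¬ InS n k i) →
                   2 ^ c + suc z ≤ n × n < 2 ^ suc c + z × n < 2 ^ (z + suc c)
  least-S-bounds z c refl (inj₂ (k≤z , _)) _ = contradiction k≤z (ℕ.m+1+n≰m (suc z))
  least-S-bounds {n} z c refl (inj₁ (_ , 1+z∈S)) below =
    subst (λ e → 2 ^ e + suc z ≤ n) (trans (cong (_∸ suc z) (ℕ.+-suc z c)) (ℕ.m+n∸m≡n z c)) 1+z∈S ,
    ℕ.≰⇒> (λ z∈S → below z (ℕ.n<1+n z)
      (inj₁ (ℕ.m≤m+n (suc z) (suc c) , subst (λ e → 2 ^ e + z ≤ n) (sym (ℕ.m+n∸m≡n z (suc c))) z∈S))) ,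
    ℕ.≰⇒> (λ 0∈S → below 0 (s≤s z≤n) (inj₁ (s≤s z≤n , subst (_≤ n) (sym (ℕ.+-identityʳ _)) 0∈S)))

  tuple-profile : ∀ {n k z} → 2 ≤ k → k < n → InS n k z → (∀ i → i < z → ¬ InS n k i) →
                  WeightProfile n k (smin n k) (tuple n k z)
  tuple-profile {k = zero} () _ _ _
  tuple-profile {n} {suc k} {zero} _ _ (inj₁ (_ , 0∈S)) _ =
    tuple-profile-zero k (subst (_≤ n) (ℕ.+-identityʳ _) 0∈S)
  tuple-profile {n} {suc k} {suc z} _ k<n (inj₂ (k≤z , _)) below =
    contradiction (last-index∈S (ℕ.<⇒≤ k<n)) (below k k≤z)
  tuple-profile {n} {suc k} {suc z} _ _ z∈S@(inj₁ (s≤s z<k , _)) below =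
    subst (λ k → WeightProfile n k (smin n k) (tuple n k (suc z))) k≡
      (tuple-profile-suc z c (least-S-bounds z c k≡ z∈S below))
    where
    c : ℕ
    c = k ∸ suc z
    k≡ : suc z + suc c ≡ suc k
    k≡ = trans (ℕ.+-suc (suc z) c) (cong suc (ℕ.m+[n∸m]≡n z<k))

open Tuples

module GreedyChoice where
  open import Data.Nat using (_+_; _∸_; _⊔_; _<?_)
  open ≡ using (refl; sym; cong; subst)

  -- After a part has covered the exponents e, …, d - 1, the remaining target is [0, e); the later parts
  -- are all at least s, so a nonzero target is raised to s, overlapping harmlessly with what is covered.
  raise : ℕ → ℕ → ℕ
  raise s zero    = zero
  raise s (suc e) = suc e ⊔ s

  greedy : ℕ → ℕ → List ℕ → List (Maybe ℕ)
  greedy s d []       = []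
  greedy s d (x ∷ xs) with d <? x
  ... | yes _ = nothing ∷ greedy s d xs
  ... | no  _ = just (d ∸ x) ∷ greedy s (raise s (d ∸ x)) xs

  -- Coefficient nothing stands for 0 and just e for λ^e; a part x with coefficient λ^e then
  -- contributes the entries λ^e, …, λ^(e+x-1), whose exponents are listed here.
  exponents : List (Maybe ℕ) → List ℕ → List ℕ
  exponents (nothing ∷ es) (x ∷ xs) = exponents es xs
  exponents (just e  ∷ es) (x ∷ xs) = applyUpTo (e +_) x ++ exponents es xs
  exponents _              _        = []

  Reachable : ℕ → List ℕ → ℕ → Set
  Reachable s xs d = d ≡ 0 ⊎ (s ≤ d × d ≤ sum xs)

  length-greedy : ∀ s d xs → length (greedy s d xs) ≡ length xs
  length-greedy s d []       = refl
  length-greedy s d (x ∷ xs) with d <? x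
  ... | yes _ = cong suc (length-greedy s d xs)
  ... | no  _ = cong suc (length-greedy s (raise s (d ∸ x)) xs)

  ∈-range⇒< : ∀ {b x e} → e ∈ applyUpTo (b +_) x → e < b + x
  ∈-range⇒< {b} e∈ with ∈-applyUpTo⁻ (b +_) e∈
  ... | j , j<x , refl = ℕ.+-monoʳ-< b j<x

  ∈-range⁺ : ∀ {b x e} → b ≤ e → e < b + x → e ∈ applyUpTo (b +_) x
  ∈-range⁺ {b} {x} {e} b≤e e<b+x =
    subst (_∈ applyUpTo (b +_) x) (ℕ.m+[n∸m]≡n b≤e) (∈-applyUpTo⁺ (b +_) e∸b<x)
    where
    e∸b<x : e ∸ b < x
    e∸b<x = ℕ.+-cancelˡ-< b (e ∸ b) x (subst (_< b + x) (sym (ℕ.m+[n∸m]≡n b≤e)) e<b+x)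

  raise-≤ : ∀ {s d} e → s ≤ d → e ≤ d → raise s e ≤ d
  raise-≤ zero    s≤d e≤d = z≤n
  raise-≤ (suc e) s≤d e≤d = ℕ.⊔-lub e≤d s≤d

  ≤-raise : ∀ s e → e ≤ raise s e
  ≤-raise s zero    = z≤n
  ≤-raise s (suc e) = ℕ.m≤m⊔n (suc e) s

  admissible-≤-sum : ∀ {s xs} → Admissible s xs → 1 ≤ sum xs → s ≤ sum xs
  admissible-≤-sum (cons {x} s≤x _ _) _ = ℕ.≤-trans s≤x (ℕ.m≤m+n x _)

  reachable-raise : ∀ {s xs} → Admissible s xs → ∀ e → e ≤ sum xs → Reachable s xs (raise s e)
  reachable-raise adm zero    _   = inj₁ refl
  reachable-raise {s} adm (suc e) e≤Σ =
    inj₂ (ℕ.m≤n⊔m (suc e) s , ℕ.⊔-lub e≤Σ (admissible-≤-sum adm (ℕ.≤-trans (s≤s z≤n) e≤Σ)))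

  reachable-∸ : ∀ {s x xs d} → Reachable s (x ∷ xs) d → d ∸ x ≤ sum xs
  reachable-∸ {x = x} (inj₁ refl)     = ℕ.≤-trans (ℕ.m∸n≤m 0 x) z≤n
  reachable-∸ {x = x} (inj₂ (_ , d≤)) = ℕ.m≤n+o⇒m∸n≤o _ x d≤

  reachable-skip : ∀ {s x xs d} → Reachable s (x ∷ xs) d → d < x → x ≤ s ⊎ x ≤ suc (sum xs) → Reachable s xs d
  reachable-skip (inj₁ d≡0)       _   _              = inj₁ d≡0
  reachable-skip (inj₂ (s≤d , _)) d<x (inj₁ x≤s)     = contradiction (ℕ.<-≤-trans d<x x≤s) (ℕ.≤⇒≯ s≤d)
  reachable-skip (inj₂ (s≤d , _)) d<x (inj₂ x≤1+Σ)   = inj₂ (s≤d , ℕ.≤-pred (ℕ.≤-trans d<x x≤1+Σ))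

  ∈-greedy-exponents⇒< : ∀ {s} d xs → Admissible s xs → ∀ {e} → e ∈ exponents (greedy s d xs) xs → e < d
  ∈-greedy-exponents⇒< d (x ∷ xs) (cons s≤x _ adm) e∈ with d <? x
  ... | yes _  = ∈-greedy-exponents⇒< d xs adm e∈
  ... | no d≮x with ∈-++⁻ (applyUpTo (d ∸ x +_) x) e∈
  ...   | inj₁ e∈block = subst (_ <_) (ℕ.m∸n+n≡m (ℕ.≮⇒≥ d≮x)) (∈-range⇒< e∈block)
  ...   | inj₂ e∈rest  = ℕ.<-≤-trans (∈-greedy-exponents⇒< _ xs adm e∈rest)
                           (raise-≤ (d ∸ x) (ℕ.≤-trans s≤x (ℕ.≮⇒≥ d≮x)) (ℕ.m∸n≤m d x))

  <⇒∈-greedy-exponents : ∀ {s} d xs → 1 ≤ s → Admissible s xs → Reachable s xs d →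
                         ∀ {j} → j < d → j ∈ exponents (greedy s d xs) xs
  <⇒∈-greedy-exponents d [] _   [] (inj₁ refl)        ()
  <⇒∈-greedy-exponents d [] 1≤s [] (inj₂ (s≤d , d≤0)) j<d = contradiction (ℕ.≤-trans 1≤s s≤d) (ℕ.≤⇒≯ d≤0)
  <⇒∈-greedy-exponents {s} d (x ∷ xs) 1≤s (cons _ x-bound adm) d-reachable {j} j<d with d <? x
  ... | yes d<x = <⇒∈-greedy-exponents d xs 1≤s adm (reachable-skip {xs = xs} d-reachable d<x x-bound) j<d
  ... | no d≮x with j <? raise s (d ∸ x)
  ...   | yes j<d′ = ∈-++⁺ʳ (applyUpTo (d ∸ x +_) x) (<⇒∈-greedy-exponents _ xs 1≤s adm
                       (reachable-raise adm (d ∸ x) (reachable-∸ {x = x} {xs} d-reachable)) j<d′)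
  ...   | no j≮d′  = ∈-++⁺ˡ (∈-range⁺ (ℕ.≤-trans (≤-raise s (d ∸ x)) (ℕ.≮⇒≥ j≮d′))
                                      (subst (j <_) (sym (ℕ.m∸n+n≡m (ℕ.≮⇒≥ d≮x))) j<d))

open GreedyChoice

funToFin-cong : ∀ {m n} {f g : Fin m → Fin n} → (∀ i → f i ≡ g i) → funToFin f ≡ funToFin g
funToFin-cong {zero}  _   = ≡.refl
funToFin-cong {suc m} f≗g = ≡.cong₂ Fin.combine (f≗g zero) (funToFin-cong (f≗g ∘ suc))

finToFun-injective : ∀ {m n} {e₁ e₂ : Fin (n ℕ.^ m)} → (∀ i → finToFun {n} {m} e₁ i ≡ finToFun e₂ i) → e₁ ≡ e₂
finToFun-injective {m} {n} {e₁} {e₂} e₁≗e₂ =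
  ≡.trans (≡.sym (Fin.funToFin-finToFin {m} {n} e₁))
          (≡.trans (funToFin-cong e₁≗e₂) (Fin.funToFin-finToFin {m} {n} e₂))

distinct⇒1<n : ∀ {n} (i j : Fin n) → ¬ i ≡ j → 1 < n
distinct⇒1<n {suc (suc n)} _    _    _   = s≤s (s≤s z≤n)
distinct⇒1<n {suc zero}    zero zero i≢j = contradiction ≡.refl i≢j

∀-init-last : ∀ {a n} {P : Fin (suc n) → Set a} → P (fromℕ n) → (∀ j → P (inject₁ j)) → ∀ i → P i
∀-init-last Pₗ Pᵢ i with Top.view i
... | Top.‵fromℕ     = Pₗ
... | Top.‵inject₁ j = Pᵢ j

module FieldProperties (L : Field) where
  open Field L hiding (zero)
  open FieldTheory L
  open import Algebra.Properties.Ring ring public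
    using (-1*x≈-x; -‿distribʳ-*; x∙y⁻¹≈ε⇒x≈y; x≈y⇒x∙y⁻¹≈ε; +-inverseʳ-unique; [y-z]x≈yx-zx)
  open import Algebra.Properties.CommutativeSemigroup *-commutativeSemigroup public using (x∙yz≈y∙xz)
  open import Algebra.Properties.Semiring.Sum semiring
    using (sum-cong-≋; sum-replicate-zero; ∑-distrib-+; *-distribˡ-sum; sum-init-last)
    renaming (sum to ∑)
  open import Algebra.Properties.Semiring.Exp semiring using (_^_; ^-homo-*)
  open import Relation.Binary.Reasoning.Setoid setoid

  Σᶠ≡∑ : ∀ {r} (f : Fin r → Carrier) → Σᶠ f ≡ ∑ f
  Σᶠ≡∑ {zero}  f = ≡.refl
  Σᶠ≡∑ {suc r} f = ≡.cong (f zero +_) (Σᶠ≡∑ (f ∘ suc))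

  module _ {r : ℕ} where

    Σᶠ-cong : {f g : Fin r → Carrier} → (∀ i → f i ≈ g i) → Σᶠ f ≈ Σᶠ g
    Σᶠ-cong {f} {g} f≈g rewrite Σᶠ≡∑ f | Σᶠ≡∑ g = sum-cong-≋ f≈g

    Σᶠ-zero : {f : Fin r → Carrier} → (∀ i → f i ≈ 0#) → Σᶠ f ≈ 0#
    Σᶠ-zero {f} f≈0 rewrite Σᶠ≡∑ f = trans (sum-cong-≋ f≈0) (sum-replicate-zero r)

    Σᶠ-+ : (f g : Fin r → Carrier) → Σᶠ (λ i → f i + g i) ≈ Σᶠ f + Σᶠ g
    Σᶠ-+ f g rewrite Σᶠ≡∑ (λ i → f i + g i) | Σᶠ≡∑ f | Σᶠ≡∑ g = ∑-distrib-+ f g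

    *-distribˡ-Σᶠ : ∀ c (f : Fin r → Carrier) → c * Σᶠ f ≈ Σᶠ (λ i → c * f i)
    *-distribˡ-Σᶠ c f rewrite Σᶠ≡∑ f | Σᶠ≡∑ (λ i → c * f i) = *-distribˡ-sum c f

  Σᶠ-neg : ∀ {r} (f : Fin r → Carrier) → Σᶠ (λ i → - f i) ≈ - Σᶠ f
  Σᶠ-neg f = begin
    Σᶠ (λ i → - f i)        ≈⟨ Σᶠ-cong (λ i → -1*x≈-x (f i)) ⟨
    Σᶠ (λ i → - 1# * f i)   ≈⟨ *-distribˡ-Σᶠ (- 1#) f ⟨
    - 1# * Σᶠ f             ≈⟨ -1*x≈-x (Σᶠ f) ⟩
    - Σᶠ f                  ∎

  Σᶠ-init-last : ∀ {r} (f : Fin (suc r) → Carrier) → Σᶠ f ≈ Σᶠ (init f) + last f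
  Σᶠ-init-last f rewrite Σᶠ≡∑ f | Σᶠ≡∑ (init f) = sum-init-last f

  δ : ∀ {r} → Fin r → Fin r → Carrier
  δ zero    zero    = 1#
  δ zero    (suc j) = 0#
  δ (suc i) zero    = 0#
  δ (suc i) (suc j) = δ i j

  Σᶠ-δ : ∀ {r} (i : Fin r) (v : Fin r → Carrier) → Σᶠ (λ j → δ i j * v j) ≈ v i
  Σᶠ-δ zero    v = trans (+-cong (*-identityˡ (v zero)) (Σᶠ-zero (λ j → zeroˡ (v (suc j))))) (+-identityʳ (v zero))
  Σᶠ-δ (suc i) v = trans (+-cong (zeroˡ (v zero)) (Σᶠ-δ i (v ∘ suc))) (+-identityˡ (v (suc i)))

  x*y≈0⇒y≈0 : ∀ {x y} → ¬ x ≈ 0# → x * y ≈ 0# → y ≈ 0#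
  x*y≈0⇒y≈0 {x} {y} x≉0 xy≈0 with inverse x x≉0
  ... | x⁻¹ , xx⁻¹≈1 = begin
    y              ≈⟨ *-identityˡ y ⟨
    1# * y         ≈⟨ *-congʳ (trans (*-comm x⁻¹ x) xx⁻¹≈1) ⟨
    (x⁻¹ * x) * y  ≈⟨ *-assoc x⁻¹ x y ⟩
    x⁻¹ * (x * y)  ≈⟨ *-congˡ xy≈0 ⟩
    x⁻¹ * 0#       ≈⟨ zeroʳ x⁻¹ ⟩
    0#             ∎

  *-cancelˡ : ∀ {x y z} → ¬ x ≈ 0# → x * y ≈ x * z → y ≈ z
  *-cancelˡ {x} {y} {z} x≉0 xy≈xz = x∙y⁻¹≈ε⇒x≈y y z (x*y≈0⇒y≈0 x≉0 (begin
    x * (y - z)      ≈⟨ distribˡ x y (- z) ⟩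
    x * y + x * - z  ≈⟨ +-cong xy≈xz (sym (-‿distribʳ-* x z)) ⟩
    x * z - x * z    ≈⟨ -‿inverseʳ (x * z) ⟩
    0#               ∎))

  inverse-unique : ∀ {x y z} → x * y ≈ 1# → x * z ≈ 1# → y ≈ z
  inverse-unique {x} {y} {z} xy≈1 xz≈1 = begin
    y            ≈⟨ *-identityʳ y ⟨
    y * 1#       ≈⟨ *-congˡ xz≈1 ⟨
    y * (x * z)  ≈⟨ *-assoc y x z ⟨
    (y * x) * z  ≈⟨ *-congʳ (trans (*-comm y x) xy≈1) ⟩
    1# * z       ≈⟨ *-identityˡ z ⟩
    z            ∎

  pow≡^ : ∀ x n → pow x n ≡ x ^ n
  pow≡^ x zero    = ≡.refl
  pow≡^ x (suc n) = ≡.cong (x *_) (pow≡^ x n)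

  pow-+ : ∀ x a b → pow x (a ℕ.+ b) ≈ pow x a * pow x b
  pow-+ x a b rewrite pow≡^ x (a ℕ.+ b) | pow≡^ x a | pow≡^ x b = ^-homo-* x a b

  pow-≉0 : ∀ {x} n → ¬ x ≈ 0# → ¬ pow x n ≈ 0#
  pow-≉0 zero    x≉0 = 1≉0
  pow-≉0 (suc n) x≉0 xⁿ⁺¹≈0 = pow-≉0 n x≉0 (x*y≈0⇒y≈0 x≉0 xⁿ⁺¹≈0)

  inverse-power : ∀ {x y} a d → ¬ x ≈ 0# → x * y ≈ 1# → pow x a ≈ pow x (a ℕ.+ suc d) → y ≈ pow x d
  inverse-power {x} {y} a d x≉0 xy≈1 xᵃ≈xᵃ⁺ᵈ⁺¹ = inverse-unique xy≈1 (sym (*-cancelˡ (pow-≉0 a x≉0) (begin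
    pow x a * 1#                ≈⟨ *-identityʳ (pow x a) ⟩
    pow x a                     ≈⟨ xᵃ≈xᵃ⁺ᵈ⁺¹ ⟩
    pow x (a ℕ.+ suc d)         ≈⟨ pow-+ x a (suc d) ⟩
    pow x a * (x * pow x d)     ∎)))

module Spans (L : Field) (K : Field.Carrier L → Set) (K-subfield : FieldTheory.IsSubfield L K) where
  open Field L hiding (zero)
  open FieldTheory L
  open OverSubfield K
  open IsSubfield K-subfield
  open FieldProperties L
  open import Relation.Binary.Reasoning.Setoid setoid

  δ∈K : ∀ {r} (i j : Fin r) → K (δ i j)
  δ∈K zero    zero    = has1
  δ∈K zero    (suc j) = has0
  δ∈K (suc i) zero    = has0
  δ∈K (suc i) (suc j) = δ∈K i j

  module SpanOf {r} {v : Fin r → Carrier} where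

    span-resp : ∀ {x y} → x ≈ y → InSpan v x → InSpan v y
    span-resp x≈y (c , c∈K , x≈Σ) = c , c∈K , trans (sym x≈y) x≈Σ

    span-0 : InSpan v 0#
    span-0 = (λ _ → 0#) , (λ _ → has0) , sym (Σᶠ-zero (λ i → zeroˡ (v i)))

    span-member : ∀ i → InSpan v (v i)
    span-member i = δ i , δ∈K i , sym (Σᶠ-δ i v)

    span-+ : ∀ {x y} → InSpan v x → InSpan v y → InSpan v (x + y)
    span-+ {x} {y} (a , a∈K , x≈Σ) (b , b∈K , y≈Σ) = (λ i → a i + b i) , (λ i → close+ (a∈K i) (b∈K i)) , (begin
      x + y                                      ≈⟨ +-cong x≈Σ y≈Σ ⟩
      Σᶠ (λ i → a i * v i) + Σᶠ (λ i → b i * v i) ≈⟨ Σᶠ-+ (λ i → a i * v i) (λ i → b i * v i) ⟨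
      Σᶠ (λ i → a i * v i + b i * v i)            ≈⟨ Σᶠ-cong (λ i → distribʳ (v i) (a i) (b i)) ⟨
      Σᶠ (λ i → (a i + b i) * v i)                ∎)

    span-* : ∀ {c x} → K c → InSpan v x → InSpan v (c * x)
    span-* {c} {x} c∈K (a , a∈K , x≈Σ) = (λ i → c * a i) , (λ i → close* c∈K (a∈K i)) , (begin
      c * x                        ≈⟨ *-congˡ x≈Σ ⟩
      c * Σᶠ (λ i → a i * v i)     ≈⟨ *-distribˡ-Σᶠ c (λ i → a i * v i) ⟩
      Σᶠ (λ i → c * (a i * v i))   ≈⟨ Σᶠ-cong (λ i → *-assoc c (a i) (v i)) ⟨
      Σᶠ (λ i → (c * a i) * v i)   ∎)

    span-combination : ∀ {p} (c w : Fin p → Carrier) → (∀ j → K (c j)) → (∀ j → InSpan v (w j)) →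
                       InSpan v (Σᶠ (λ j → c j * w j))
    span-combination {zero}  c w c∈K w∈span = span-0
    span-combination {suc p} c w c∈K w∈span =
      span-+ (span-* (c∈K zero) (w∈span zero)) (span-combination (c ∘ suc) (w ∘ suc) (c∈K ∘ suc) (w∈span ∘ suc))

    span-*⁻¹ : ∀ {c x} → K c → ¬ c ≈ 0# → InSpan v (c * x) → InSpan v x
    span-*⁻¹ {c} {x} c∈K c≉0 cx∈span with inverse c c≉0
    ... | c⁻¹ , cc⁻¹≈1 = span-resp c⁻¹cx≈x (span-* (closeInv c∈K c≉0 cc⁻¹≈1) cx∈span)
      where
      c⁻¹cx≈x : c⁻¹ * (c * x) ≈ x
      c⁻¹cx≈x = begin
        c⁻¹ * (c * x)  ≈⟨ *-assoc c⁻¹ c x ⟨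
        (c⁻¹ * c) * x  ≈⟨ *-congʳ (trans (*-comm c⁻¹ c) cc⁻¹≈1) ⟩
        1# * x         ≈⟨ *-identityˡ x ⟩
        x              ∎

  open SpanOf public

  module _ {r} {v w : Fin r → Carrier} (v≈w : ∀ i → v i ≈ w i) where

    Σᶠ-family-cong : ∀ (c : Fin r → Carrier) → Σᶠ (λ i → c i * v i) ≈ Σᶠ (λ i → c i * w i)
    Σᶠ-family-cong c = Σᶠ-cong (λ i → *-congˡ (v≈w i))

    span-family-cong : ∀ {x} → InSpan v x → InSpan w x
    span-family-cong (c , c∈K , x≈Σ) = c , c∈K , trans x≈Σ (Σᶠ-family-cong c)

    independent-family-cong : Independent v → Independent w
    independent-family-cong v-ind c c∈K Σ≈0 = v-ind c c∈K (trans (Σᶠ-family-cong c) Σ≈0)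

  independent-*ˡ : ∀ {r a} {v : Fin r → Carrier} → ¬ a ≈ 0# → Independent v → Independent (λ i → a * v i)
  independent-*ˡ {a = a} {v} a≉0 v-ind c c∈K Σ≈0 = v-ind c c∈K (x*y≈0⇒y≈0 a≉0 (begin
    a * Σᶠ (λ i → c i * v i)     ≈⟨ *-distribˡ-Σᶠ a (λ i → c i * v i) ⟩
    Σᶠ (λ i → a * (c i * v i))   ≈⟨ Σᶠ-cong (λ i → x∙yz≈y∙xz a (c i) (v i)) ⟩
    Σᶠ (λ i → c i * (a * v i))   ≈⟨ Σ≈0 ⟩
    0#                           ∎))

  independent-injective : ∀ {p} {w a b : Fin p → Carrier} → Independent w → (∀ j → K (a j)) → (∀ j → K (b j)) →
                          Σᶠ (λ j → a j * w j) ≈ Σᶠ (λ j → b j * w j) → ∀ j → a j ≈ b j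
  independent-injective {w = w} {a} {b} w-ind a∈K b∈K Σa≈Σb j =
    x∙y⁻¹≈ε⇒x≈y (a j) (b j) (w-ind (λ j → a j - b j) (λ j → close+ (a∈K j) (close- (b∈K j))) Σ≈0 j)
    where
    Σ≈0 : Σᶠ (λ j → (a j - b j) * w j) ≈ 0#
    Σ≈0 = begin
      Σᶠ (λ j → (a j - b j) * w j)                        ≈⟨ Σᶠ-cong (λ j → [y-z]x≈yx-zx (w j) (a j) (b j)) ⟩
      Σᶠ (λ j → a j * w j - b j * w j)                    ≈⟨ Σᶠ-+ (λ j → a j * w j) (λ j → - (b j * w j)) ⟩
      Σᶠ (λ j → a j * w j) + Σᶠ (λ j → - (b j * w j))     ≈⟨ +-congˡ (Σᶠ-neg (λ j → b j * w j)) ⟩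
      Σᶠ (λ j → a j * w j) - Σᶠ (λ j → b j * w j)         ≈⟨ x≈y⇒x∙y⁻¹≈ε Σa≈Σb ⟩
      0#                                                  ∎

module FiniteSubfield (L : Field) (K : Field.Carrier L → Set) (K-subfield : FieldTheory.IsSubfield L K)
                      (q : ℕ) (card : FieldTheory.HasCard L K q) where
  open Field L hiding (zero)
  open FieldTheory L
  open OverSubfield K
  open IsSubfield K-subfield
  open FieldProperties L
  open Spans L K K-subfield
  open import Relation.Binary.Reasoning.Setoid setoid

  ι : Fin q → Carrier
  ι = proj₁ card

  ι-injective : ∀ i j → ι i ≈ ι j → i ≡ j
  ι-injective = proj₁ (proj₂ card)

  ι∈K : ∀ i → K (ι i)
  ι∈K i = proj₂ (proj₂ (proj₂ card) (ι i)) i refl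

  index : ∀ {x} → K x → Fin q
  index {x} x∈K = proj₁ (proj₁ (proj₂ (proj₂ card) x) x∈K)

  ≈ι-index : ∀ {x} (x∈K : K x) → x ≈ ι (index x∈K)
  ≈ι-index {x} x∈K = proj₂ (proj₁ (proj₂ (proj₂ card) x) x∈K)

  module _ {x y} (x∈K : K x) (y∈K : K y) where

    index-injective : index x∈K ≡ index y∈K → x ≈ y
    index-injective eq = trans (≈ι-index x∈K) (trans (reflexive (≡.cong ι eq)) (sym (≈ι-index y∈K)))

    index-cong : x ≈ y → index x∈K ≡ index y∈K
    index-cong x≈y = ι-injective _ _ (trans (sym (≈ι-index x∈K)) (trans x≈y (≈ι-index y∈K)))

    K-≟ : Dec (x ≈ y)
    K-≟ = map′ index-injective index-cong (index x∈K Fin.≟ index y∈K)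

  1<q : 1 < q
  1<q = distinct⇒1<n (index has0) (index has1) (λ eq → 1≉0 (sym (index-injective has0 has1 eq)))

  encode : ∀ {r} {v : Fin r → Carrier} {x} → InSpan v x → Fin (q ℕ.^ r)
  encode (c , c∈K , _) = funToFin (λ i → index (c∈K i))

  encode-injective : ∀ {r} {v : Fin r → Carrier} {x y} (p : InSpan v x) (p′ : InSpan v y) →
                     encode p ≡ encode p′ → x ≈ y
  encode-injective {v = v} {x} {y} (c , c∈K , x≈Σ) (c′ , c′∈K , y≈Σ) eq = begin
    x                       ≈⟨ x≈Σ ⟩
    Σᶠ (λ i → c i * v i)    ≈⟨ Σᶠ-cong (λ i → *-congʳ (c≈c′ i)) ⟩
    Σᶠ (λ i → c′ i * v i)   ≈⟨ y≈Σ ⟨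
    y                       ∎
    where
    c≈c′ : ∀ i → c i ≈ c′ i
    c≈c′ i = index-injective (c∈K i) (c′∈K i) (≡.trans (≡.sym (Fin.finToFun-funToFin _ i))
               (≡.trans (≡.cong (λ e → finToFun e i) eq) (Fin.finToFun-funToFin _ i)))

  -- The q^p combinations of w with coefficients in K are distinct elements of span v, which has at most q^r.
  independent⇒≤ : ∀ {p r} {w : Fin p → Carrier} {v : Fin r → Carrier} →
                  Independent w → (∀ j → InSpan v (w j)) → p ≤ r
  independent⇒≤ {p} {r} {w} {v} w-ind w∈span =
    ℕ.≮⇒≥ (λ r<p → ℕ.<⇒≱ (ℕ.^-monoʳ-< q 1<q r<p) (Fin.injective⇒≤ code-injective))
    where
    coefficients : Fin (q ℕ.^ p) → Fin p → Carrier
    coefficients e j = ι (finToFun e j)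
    combination∈span : ∀ e → InSpan v (Σᶠ (λ j → coefficients e j * w j))
    combination∈span e = span-combination (coefficients e) w (ι∈K ∘ finToFun e) w∈span
    code : Fin (q ℕ.^ p) → Fin (q ℕ.^ r)
    code e = encode (combination∈span e)
    code-injective : Injective _≡_ _≡_ code
    code-injective {e₁} {e₂} eq = finToFun-injective λ j → ι-injective _ _
      (independent-injective w-ind (ι∈K ∘ finToFun e₁) (ι∈K ∘ finToFun e₂)
        (encode-injective (combination∈span e₁) (combination∈span e₂) eq) j)

  span-sequence-repeats : ∀ {r} {v : Fin r → Carrier} (f : ℕ → Carrier) → (∀ n → InSpan v (f n)) →
                          ∃[ a ] ∃[ d ] f a ≈ f (a ℕ.+ suc d)
  span-sequence-repeats {r} f f∈span with Fin.pigeonhole (ℕ.n<1+n (q ℕ.^ r)) (λ i → encode (f∈span (toℕ i)))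
  ... | i , j , i<j , codes≡ = toℕ i , d ,
    trans (encode-injective (f∈span (toℕ i)) (f∈span (toℕ j)) codes≡) (reflexive (≡.cong f j≡i+1+d))
    where
    d : ℕ
    d = toℕ j ℕ.∸ suc (toℕ i)
    j≡i+1+d : toℕ j ≡ toℕ i ℕ.+ suc d
    j≡i+1+d = ≡.sym (≡.trans (ℕ.+-suc (toℕ i) d) (ℕ.m+[n∸m]≡n i<j))

  independent-extend : ∀ {r} {v : Fin (suc r) → Carrier} →
                       Independent (init v) → ¬ InSpan (init v) (last v) → Independent v
  independent-extend {r} {v} init-ind last∉span c c∈K Σ≈0 = by-cases (K-≟ (c∈K (fromℕ r)) has0)
    where
    Σinit : Carrier
    Σinit = Σᶠ (λ j → init c j * init v j)
    Σinit+cₗvₗ≈0 : Σinit + last c * last v ≈ 0#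
    Σinit+cₗvₗ≈0 = trans (sym (Σᶠ-init-last (λ i → c i * v i))) Σ≈0
    by-cases : Dec (last c ≈ 0#) → ∀ i → c i ≈ 0#
    by-cases (yes cₗ≈0) = ∀-init-last cₗ≈0 (init-ind (init c) (c∈K ∘ inject₁) (begin
      Σinit                      ≈⟨ +-identityʳ Σinit ⟨
      Σinit + 0#                 ≈⟨ +-congˡ (trans (*-congʳ cₗ≈0) (zeroˡ (last v))) ⟨
      Σinit + last c * last v    ≈⟨ Σinit+cₗvₗ≈0 ⟩
      0#                         ∎))
    by-cases (no cₗ≉0) = contradiction (span-*⁻¹ (c∈K (fromℕ r)) cₗ≉0 cₗvₗ∈span) last∉span
      where
      cₗvₗ∈span : InSpan (init v) (last c * last v)
      cₗvₗ∈span = span-resp (trans (-1*x≈-x Σinit) (sym (+-inverseʳ-unique Σinit (last c * last v) Σinit+cₗvₗ≈0)))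
                    (span-* (close- has1) (init c , c∈K ∘ inject₁ , refl))

module Generator (L : Field) (K : Field.Carrier L → Set) (K-subfield : FieldTheory.IsSubfield L K)
                 (q : ℕ) (card : FieldTheory.HasCard L K q)
                 (m : ℕ) (degree : FieldTheory.OverSubfield.Degree L K m)
                 (λ₀ : Field.Carrier L) (generates : FieldTheory.OverSubfield.Generates L K λ₀) where
  open Field L hiding (zero)
  open FieldTheory L
  open OverSubfield K
  open IsSubfield K-subfield
  open FieldProperties L
  open FiniteSubfield L K K-subfield q card
  open import Relation.Binary.Reasoning.Setoid setoid

  powers : ∀ t → Fin t → Carrier
  powers t i = pow λ₀ (toℕ i)

  -- V is closed under multiplication by λ₀, hence a subring; finiteness makes it a subfield.
  module PowerSpan (t : ℕ) (closed : InSpan (powers (suc t)) (pow λ₀ (suc t))) where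

    open Spans.SpanOf L K K-subfield {v = powers (suc t)}

    V : Carrier → Set
    V = InSpan (powers (suc t))

    pow∈V : ∀ n → n ≤ suc t → V (pow λ₀ n)
    pow∈V n n≤1+t with n ℕ.<? suc t
    ... | yes n<1+t = span-resp (reflexive (≡.cong (pow λ₀) (Fin.toℕ-fromℕ< n<1+t))) (span-member (Fin.fromℕ< n<1+t))
    ... | no  n≮1+t = ≡.subst (V ∘ pow λ₀) (≡.sym (ℕ.≤-antisym n≤1+t (ℕ.≮⇒≥ n≮1+t))) closed

    λ₀*-closed : ∀ {y} → V y → V (λ₀ * y)
    λ₀*-closed {y} (a , a∈K , y≈Σ) =
      span-resp (sym λ₀y≈Σ)
        (span-combination a (pow λ₀ ∘ suc ∘ toℕ) a∈K (λ i → pow∈V (suc (toℕ i)) (Fin.toℕ<n i)))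
      where
      λ₀y≈Σ : λ₀ * y ≈ Σᶠ (λ i → a i * pow λ₀ (suc (toℕ i)))
      λ₀y≈Σ = begin
        λ₀ * y                                  ≈⟨ *-congˡ y≈Σ ⟩
        λ₀ * Σᶠ (λ i → a i * powers (suc t) i)  ≈⟨ *-distribˡ-Σᶠ λ₀ (λ i → a i * powers (suc t) i) ⟩
        Σᶠ (λ i → λ₀ * (a i * pow λ₀ (toℕ i)))  ≈⟨ Σᶠ-cong (λ i → x∙yz≈y∙xz λ₀ (a i) (pow λ₀ (toℕ i))) ⟩
        Σᶠ (λ i → a i * pow λ₀ (suc (toℕ i)))   ∎

    pow*-closed : ∀ n {y} → V y → V (pow λ₀ n * y)
    pow*-closed zero    y∈V = span-resp (sym (*-identityˡ _)) y∈V
    pow*-closed (suc n) y∈V = span-resp (sym (*-assoc λ₀ (pow λ₀ n) _)) (λ₀*-closed (pow*-closed n y∈V))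

    *-closed : ∀ {x y} → V x → V y → V (x * y)
    *-closed {x} {y} (a , a∈K , x≈Σ) y∈V =
      span-resp (sym xy≈Σ) (span-combination a (λ i → pow λ₀ (toℕ i) * y) a∈K (λ i → pow*-closed (toℕ i) y∈V))
      where
      xy≈Σ : x * y ≈ Σᶠ (λ i → a i * (pow λ₀ (toℕ i) * y))
      xy≈Σ = begin
        x * y                                    ≈⟨ *-comm x y ⟩
        y * x                                    ≈⟨ *-congˡ x≈Σ ⟩
        y * Σᶠ (λ i → a i * powers (suc t) i)    ≈⟨ *-distribˡ-Σᶠ y (λ i → a i * powers (suc t) i) ⟩
        Σᶠ (λ i → y * (a i * pow λ₀ (toℕ i)))    ≈⟨ Σᶠ-cong (λ i → x∙yz≈y∙xz y (a i) (pow λ₀ (toℕ i))) ⟩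
        Σᶠ (λ i → a i * (y * pow λ₀ (toℕ i)))    ≈⟨ Σᶠ-cong (λ i → *-congˡ {a i} (*-comm y (pow λ₀ (toℕ i)))) ⟩
        Σᶠ (λ i → a i * (pow λ₀ (toℕ i) * y))    ∎

    1∈V : V 1#
    1∈V = span-member zero

    pow-closed : ∀ {x} → V x → ∀ n → V (pow x n)
    pow-closed x∈V zero    = 1∈V
    pow-closed x∈V (suc n) = *-closed x∈V (pow-closed x∈V n)

    ⁻¹-closed : ∀ {x y} → V x → ¬ x ≈ 0# → x * y ≈ 1# → V y
    ⁻¹-closed {x} x∈V x≉0 xy≈1 with span-sequence-repeats {v = powers (suc t)} (pow x) (pow-closed x∈V)
    ... | a , d , xᵃ≈xᵃ⁺ᵈ⁺¹ = span-resp (sym (inverse-power a d x≉0 xy≈1 xᵃ≈xᵃ⁺ᵈ⁺¹)) (pow-closed x∈V d)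

    V-subfield : IsSubfield V
    V-subfield = record
      { resp     = span-resp
      ; has0     = span-0
      ; has1     = 1∈V
      ; close+   = span-+
      ; close-   = λ x∈V → span-resp (-1*x≈-x _) (span-* (close- has1) x∈V)
      ; close*   = *-closed
      ; closeInv = ⁻¹-closed
      }

    V-universal : ∀ x → V x
    V-universal = generates V V-subfield (λ {x} x∈K → span-resp (*-identityʳ x) (span-* x∈K 1∈V))
                    (span-resp (*-identityʳ λ₀) (λ₀*-closed 1∈V))

  -- Opened only here: inside PowerSpan the family v = powers (suc t) has to be given explicitly.
  open Spans L K K-subfield

  closed-powers⇒m≤ : ∀ {t} → InSpan (powers (suc t)) (pow λ₀ (suc t)) → m ≤ suc t
  closed-powers⇒m≤ {t} closed = independent⇒≤ {v = powers (suc t)} (proj₁ (proj₂ degree))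
    (λ j → PowerSpan.V-universal t closed (proj₁ degree j))

  pow∉span-powers : ∀ t → t < m → ¬ InSpan (powers t) (pow λ₀ t)
  pow∉span-powers zero    _     (_ , _ , 1≈0) = 1≉0 1≈0
  pow∉span-powers (suc t) 1+t<m closed        = ℕ.<⇒≱ 1+t<m (closed-powers⇒m≤ closed)

  powers-independent : ∀ t → t ≤ m → Independent (powers t)
  powers-independent zero    _     _ _ _ ()
  powers-independent (suc t) 1+t≤m = independent-extend {v = powers (suc t)}
    (independent-family-cong init≈ (powers-independent t (ℕ.<⇒≤ 1+t≤m)))
    (λ last∈span → pow∉span-powers t 1+t≤m (span-resp {v = powers t}
      (reflexive (≡.cong (pow λ₀) (Fin.toℕ-fromℕ t))) (span-family-cong (sym ∘ init≈) last∈span)))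
    where
    init≈ : ∀ j → powers t j ≈ init (powers (suc t)) j
    init≈ j = reflexive (≡.cong (pow λ₀) (≡.sym (Fin.toℕ-inject₁ j)))

module Codewords (L : Field) (K : Field.Carrier L → Set) (K-subfield : FieldTheory.IsSubfield L K)
                 (q : ℕ) (card : FieldTheory.HasCard L K q)
                 (m : ℕ) (degree : FieldTheory.OverSubfield.Degree L K m)
                 (λ₀ : Field.Carrier L) (generates : FieldTheory.OverSubfield.Generates L K λ₀) where
  open Field L hiding (zero)
  open FieldTheory L
  open OverSubfield K
  open FieldProperties L
  open Spans L K K-subfield
  open FiniteSubfield L K K-subfield q card
  open Generator L K K-subfield q card m degree λ₀ generates

  span-∈ : ∀ {xs y} → y ∈ xs → InSpan (lookup xs) y
  span-∈ y∈xs = span-resp (reflexive (≡.sym (lookup-index y∈xs))) (span-member (Any.index y∈xs))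

  ∈-≉0⇒Nonzero : ∀ {xs y} → y ∈ xs → ¬ y ≈ 0# → Nonzero xs
  ∈-≉0⇒Nonzero y∈xs y≉0 = Any.index y∈xs , λ entry≈0 → y≉0 (trans (reflexive (lookup-index y∈xs)) entry≈0)

  rankWeight-≤-length : ∀ {xs d} → RankWeight xs d → d ≤ length xs
  rankWeight-≤-length (_ , b-ind , b∈span , _) = independent⇒≤ b-ind b∈span

  independent-entries⇒≤ : ∀ {p xs d} {w : Fin p → Carrier} → Independent w → (∀ j → w j ∈ xs) →
                           RankWeight xs d → p ≤ d
  independent-entries⇒≤ {xs = xs} w-ind w∈xs (b , _ , _ , xs∈span) = independent⇒≤ w-ind λ j →
    span-resp (reflexive (≡.sym (lookup-index (w∈xs j)))) (xs∈span (Any.index (w∈xs j)))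

  rankWeight-powers : ∀ {xs d} → d ≤ m →
                      (∀ {y} → y ∈ xs → y ≈ 0# ⊎ ∃[ e ] e < d × y ≈ pow λ₀ e) →
                      (∀ {j} → j < d → ∃[ y ] y ∈ xs × y ≈ pow λ₀ j) →
                      RankWeight xs d
  rankWeight-powers {xs} {d} d≤m entries powers∈ = powers d , powers-independent d d≤m , power∈span , entry∈span
    where
    power∈span : ∀ j → InSpan (lookup xs) (powers d j)
    power∈span j with powers∈ (Fin.toℕ<n j)
    ... | y , y∈xs , y≈λʲ = span-resp y≈λʲ (span-∈ y∈xs)
    entry∈span : ∀ i → InSpan (powers d) (lookup xs i)
    entry∈span i with entries (∈-lookup i)
    ... | inj₁ entry≈0 = span-resp (sym entry≈0) span-0
    ... | inj₂ (e , e<d , entry≈λᵉ) =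
      span-resp (trans (reflexive (≡.cong (pow λ₀) (Fin.toℕ-fromℕ< e<d))) (sym entry≈λᵉ)) (span-member (Fin.fromℕ< e<d))

  block : Carrier → ℕ → List Carrier
  block a x = map (a *_) (u λ₀ x)

  ∈-block⁻ : ∀ {a x y} → y ∈ block a x → ∃[ j ] j < x × y ≡ a * pow λ₀ j
  ∈-block⁻ {a} y∈ with ∈-map⁻ (a *_) y∈
  ... | _ , λʲ∈ , ≡.refl with ∈-map⁻ (pow λ₀) λʲ∈
  ...   | j , j∈ , ≡.refl = j , ∈-upTo⁻ j∈ , ≡.refl

  ∈-block⁺ : ∀ {a x j} → j < x → a * pow λ₀ j ∈ block a x
  ∈-block⁺ {a} j<x = ∈-map⁺ (a *_) (∈-map⁺ (pow λ₀) (∈-upTo⁺ j<x))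

  ∈-codeword⁻ : ∀ as ns {y} → y ∈ codeword λ₀ ns as →
                ∃[ a ] ∃[ x ] x ∈ ns × y ∈ block a x × block a x ⊆ codeword λ₀ ns as
  ∈-codeword⁻ (a ∷ as) (x ∷ ns) y∈ with ∈-++⁻ (block a x) y∈
  ... | inj₁ y∈block = a , x , here ≡.refl , y∈block , ∈-++⁺ˡ
  ... | inj₂ y∈rest with ∈-codeword⁻ as ns y∈rest
  ...   | a′ , x′ , x′∈ns , y∈block′ , block′⊆ =
          a′ , x′ , there x′∈ns , y∈block′ , ∈-++⁺ʳ (block a x) ∘ block′⊆

  length-codeword : ∀ as ns → length (codeword λ₀ ns as) ≤ sum ns
  length-codeword []       ns       = z≤n
  length-codeword (a ∷ as) []       = z≤n
  length-codeword (a ∷ as) (x ∷ ns) = begin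
    length (block a x ++ codeword λ₀ ns as)            ≡⟨ length-++ (block a x) ⟩
    length (block a x) ℕ.+ length (codeword λ₀ ns as)  ≡⟨ ≡.cong (ℕ._+ _) length-block ⟩
    x ℕ.+ length (codeword λ₀ ns as)                   ≤⟨ ℕ.+-monoʳ-≤ x (length-codeword as ns) ⟩
    x ℕ.+ sum ns                                       ∎
    where
    open ℕ.≤-Reasoning
    length-block : length (block a x) ≡ x
    length-block = ≡.trans (length-map (a *_) (u λ₀ x)) (≡.trans (length-map (pow λ₀) (upTo x)) (length-upTo x))

  rankWeight-bounds : ∀ {s ns} → Admissible s ns → sum ns ≤ m → ∀ as {d} →
                      Nonzero (codeword λ₀ ns as) → RankWeight (codeword λ₀ ns as) d → s ≤ d × d ≤ sum ns
  rankWeight-bounds {s} {ns} adm Σ≤m as {d} (i , entry≉0) weight =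
    s≤d , ℕ.≤-trans (rankWeight-≤-length {codeword λ₀ ns as} weight) (length-codeword as ns)
    where
    s≤d : s ≤ d
    s≤d with ∈-codeword⁻ as ns (∈-lookup i)
    ... | a , x , x∈ns , entry∈block , block⊆ with ∈-block⁻ entry∈block
    ...   | j , _ , entry≡aλʲ = ℕ.≤-trans (admissible-∈⇒≥ adm x∈ns)
            (independent-entries⇒≤ {xs = codeword λ₀ ns as} (independent-*ˡ a≉0 (powers-independent x x≤m))
              (λ j → block⊆ (∈-block⁺ (Fin.toℕ<n j))) weight)
      where
      a≉0 : ¬ a ≈ 0#
      a≉0 a≈0 = entry≉0 (trans (reflexive entry≡aλʲ) (trans (*-congʳ a≈0) (zeroˡ _)))
      x≤m : x ≤ m
      x≤m = ℕ.≤-trans (∈⇒≤sum x∈ns) Σ≤m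

  monomial : Maybe ℕ → Carrier
  monomial nothing  = 0#
  monomial (just e) = pow λ₀ e

  ∈-monomial-codeword⁻ : ∀ es ns {y} → y ∈ codeword λ₀ ns (map monomial es) →
                         y ≈ 0# ⊎ ∃[ e ] e ∈ exponents es ns × y ≈ pow λ₀ e
  ∈-monomial-codeword⁻ (nothing ∷ es) (x ∷ ns) y∈ with ∈-++⁻ (block 0# x) y∈
  ... | inj₁ y∈block with ∈-block⁻ y∈block
  ...   | j , _ , ≡.refl = inj₁ (zeroˡ (pow λ₀ j))
  ∈-monomial-codeword⁻ (nothing ∷ es) (x ∷ ns) y∈ | inj₂ y∈rest = ∈-monomial-codeword⁻ es ns y∈rest
  ∈-monomial-codeword⁻ (just e ∷ es) (x ∷ ns) y∈ with ∈-++⁻ (block (pow λ₀ e) x) y∈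
  ... | inj₁ y∈block with ∈-block⁻ y∈block
  ...   | j , j<x , ≡.refl = inj₂ (e ℕ.+ j , ∈-++⁺ˡ (∈-applyUpTo⁺ (e ℕ.+_) j<x) , sym (pow-+ λ₀ e j))
  ∈-monomial-codeword⁻ (just e ∷ es) (x ∷ ns) y∈ | inj₂ y∈rest with ∈-monomial-codeword⁻ es ns y∈rest
  ...   | inj₁ y≈0                = inj₁ y≈0
  ...   | inj₂ (e′ , e′∈ , y≈λᵉ′) = inj₂ (e′ , ∈-++⁺ʳ (applyUpTo (e ℕ.+_) x) e′∈ , y≈λᵉ′)

  ∈-monomial-codeword⁺ : ∀ es ns {e} → e ∈ exponents es ns →
                         ∃[ y ] y ∈ codeword λ₀ ns (map monomial es) × y ≈ pow λ₀ e
  ∈-monomial-codeword⁺ (nothing ∷ es) (x ∷ ns) e∈ with ∈-monomial-codeword⁺ es ns e∈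
  ... | y , y∈ , y≈λᵉ = y , ∈-++⁺ʳ (block 0# x) y∈ , y≈λᵉ
  ∈-monomial-codeword⁺ (just e₀ ∷ es) (x ∷ ns) e∈ with ∈-++⁻ (applyUpTo (e₀ ℕ.+_) x) e∈
  ... | inj₁ e∈range with ∈-applyUpTo⁻ (e₀ ℕ.+_) e∈range
  ...   | j , j<x , ≡.refl = pow λ₀ e₀ * pow λ₀ j , ∈-++⁺ˡ (∈-block⁺ j<x) , sym (pow-+ λ₀ e₀ j)
  ∈-monomial-codeword⁺ (just e₀ ∷ es) (x ∷ ns) e∈ | inj₂ e∈rest with ∈-monomial-codeword⁺ es ns e∈rest
  ...   | y , y∈ , y≈λᵉ = y , ∈-++⁺ʳ (block (pow λ₀ e₀) x) y∈ , y≈λᵉ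

  rankWeight-realised : ∀ {s ns} → 1 ≤ s → Admissible s ns → sum ns ≤ m → ∀ {d} → s ≤ d → d ≤ sum ns →
                        ∃[ as ] length as ≡ length ns × Nonzero (codeword λ₀ ns as) × RankWeight (codeword λ₀ ns as) d
  rankWeight-realised {s} {ns} 1≤s adm Σ≤m {d} s≤d d≤Σ =
    map monomial es , ≡.trans (length-map monomial es) (length-greedy s d ns) , nonzero , weight
    where
    es : List (Maybe ℕ)
    es = greedy s d ns
    entries : ∀ {y} → y ∈ codeword λ₀ ns (map monomial es) → y ≈ 0# ⊎ ∃[ e ] e < d × y ≈ pow λ₀ e
    entries y∈ with ∈-monomial-codeword⁻ es ns y∈
    ... | inj₁ y≈0               = inj₁ y≈0
    ... | inj₂ (e , e∈ , y≈λᵉ)   = inj₂ (e , ∈-greedy-exponents⇒< d ns adm e∈ , y≈λᵉ)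
    powers∈ : ∀ {j} → j < d → ∃[ y ] y ∈ codeword λ₀ ns (map monomial es) × y ≈ pow λ₀ j
    powers∈ j<d = ∈-monomial-codeword⁺ es ns (<⇒∈-greedy-exponents d ns 1≤s adm (inj₂ (s≤d , d≤Σ)) j<d)
    weight : RankWeight (codeword λ₀ ns (map monomial es)) d
    weight = rankWeight-powers (ℕ.≤-trans d≤Σ Σ≤m) entries powers∈
    nonzero : Nonzero (codeword λ₀ ns (map monomial es))
    nonzero with powers∈ (ℕ.<-≤-trans 1≤s s≤d)
    ... | y , y∈ , y≈1 = ∈-≉0⇒Nonzero y∈ (λ y≈0 → 1≉0 (trans (sym y≈1) y≈0))

theorem3p5 : (L : Field) →
    let open Field L
        open FieldTheory L
    in (K : Carrier → Set) → IsSubfield K →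
       (q : ℕ) → prime-power q → HasCard K q →
       (m n k : ℕ) → 2 ≤ k → k < n → n ≤ m → OverSubfield.Degree K m →
       (λ₀ : Carrier) → OverSubfield.Generates K λ₀ →
       (z : ℕ) → InS n k z → (∀ i → i < z → ¬ InS n k i) →
       let ns = tuple n k z
           s = smin n k
       in (∀ (as : List Carrier) → length as ≡ k → ∀ d →
             Nonzero (codeword λ₀ ns as) →
             OverSubfield.RankWeight K (codeword λ₀ ns as) d → s ≤ d × d ≤ n)
          × (∀ d → s ≤ d → d ≤ n →
             ∃[ as ] (length as ≡ k × Nonzero (codeword λ₀ ns as)
                      × OverSubfield.RankWeight K (codeword λ₀ ns as) d))
theorem3p5 L K K-subfield q _ card m n k 2≤k k<n n≤m degree λ₀ generates z z∈S z-least =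
  (λ as _ d nonzero weight →
     ≡.subst (λ n′ → smin n k ≤ d × d ≤ n′) sum≡ (rankWeight-bounds admissible Σ≤m as nonzero weight)) ,
  (λ d s≤d d≤n → with-length-k (rankWeight-realised 1≤s admissible Σ≤m s≤d (≡.subst (d ≤_) (≡.sym sum≡) d≤n)))
  where
  open Codewords L K K-subfield q card m degree λ₀ generates
  open WeightProfile (tuple-profile 2≤k k<n z∈S z-least)
  1≤s : 1 ≤ smin n k
  1≤s = ℕ.m≤n⊔m _ 1
  Σ≤m : sum (tuple n k z) ≤ m
  Σ≤m = ≡.subst (_≤ m) (≡.sym sum≡) n≤m
  with-length-k : ∀ {P : List (Field.Carrier L) → Set} →
                  ∃[ as ] (length as ≡ length (tuple n k z) × P as) → ∃[ as ] (length as ≡ k × P as)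
  with-length-k (as , length≡ns , P-as) = as , ≡.trans length≡ns length≡ , P-as
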